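{- Let $\mathcal X$ be a zero-nonzero pattern, and let $\mathcal X'$ be obtained from $\mathcal X$ by appending one row. Then $\operatorname{mr}\mathcal R(\mathcal X)\le \operatorname{mr}\mathcal R(\mathcal X')\le \operatorname{mr}\mathcal R(\mathcal X)+1$.
   Context: A zero-nonzero pattern is a matrix with entries in $\{0,*\}$; for a pattern with $n$ columns, columns are labeled $1,\dots,n$, and the zero set of a row is the set of column labels where that row has entry $0$. For a pattern $\mathcal X$ with $n$ columns, $\mathcal R(\mathcal X)$ denotes the set of all matroids $M$ on ground set $\{1,\dots,n\}$ such that the zero set of each row of $\mathcal X$ is a flat of $M$. For a collection $\mathcal C$ of objects having a nonnegative integer rank, $\operatorname{mr}\mathcal C$ denotes the smallest rank of an object in $\mathcal C$; $\operatorname{mr}\mathcal R(\mathcal X)$ is called the matroid minimum rank of $\mathcal X$. -}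

module Defs where

open import Data.Nat using (ℕ; zero; suc; _+_; _≤_; _<_)
open import Data.Bool using (Bool; true; false)
open import Data.Fin using (Fin; zero; suc)
open import Data.Fin.Subset using (Subset; _∪_; _∩_; _⊆_; ∣_∣; ⁅_⁆; _∉_; ⊤)
open import Data.Vec using (tabulate)
open import Data.Product using (Σ; _×_)
open import Relation.Binary.PropositionalEquality using (_≡_)

data Entry : Set where
  𝟎 : Entry
  ∗ : Entry

Pattern : ℕ → ℕ → Set
Pattern m n = Fin m → Fin n → Entry

isZero : Entry → Bool
isZero 𝟎 = true
isZero ∗ = false

zeroSet : {n : ℕ} → (Fin n → Entry) → Subset n
zeroSet ρ = tabulate (λ j → isZero (ρ j))

-- Append a row ρ at the bottom of the pattern X (new last row).
appendRow : {m n : ℕ} → Pattern m n → (Fin n → Entry) → Pattern (suc m) n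
appendRow {zero}  X ρ zero    = ρ
appendRow {suc m} X ρ zero    = X zero
appendRow {suc m} X ρ (suc i) = appendRow {m} (λ k → X (suc k)) ρ i

record Matroid (n : ℕ) : Set where
  field
    r        : Subset n → ℕ
    r-bound  : ∀ A → r A ≤ ∣ A ∣
    r-mono   : ∀ A B → A ⊆ B → r A ≤ r B
    r-submod : ∀ A B → r (A ∪ B) + r (A ∩ B) ≤ r A + r B

rank : {n : ℕ} → Matroid n → ℕ
rank M = Matroid.r M ⊤

IsFlat : {n : ℕ} → Matroid n → Subset n → Set
IsFlat M F = ∀ e → e ∉ F → Matroid.r M F < Matroid.r M (F ∪ ⁅ e ⁆)

InR : {m n : ℕ} → Pattern m n → Matroid n → Set
InR X M = ∀ i → IsFlat M (zeroSet (X i))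

IsMatroidMinRank : {m n : ℕ} → Pattern m n → ℕ → Set
IsMatroidMinRank {n = n} X k =
  Σ (Matroid n) (λ M → InR X M × rank M ≡ k)
  × (∀ (M : Matroid n) → InR X M → k ≤ rank M)

-- If M ∈ 𝓡(X′) then M ∈ 𝓡(X), since X′ only has more rows; this gives the lower bound.
-- For the upper bound take M ∈ 𝓡(X) of minimum rank and let Z be the zero set of the new
-- row. Raising the rank of A by one exactly when some element of A outside Z is not a
-- coloop of M|A yields a matroid of rank at most rank M + 1 in which every flat of M is
-- still a flat and Z becomes a flat.
module Submission where

open import Defs
open import Data.Nat using (ℕ; zero; suc; _+_; _≤_; _<_; _≤?_; z≤n; s≤s)
open import Data.Nat.Properties
open import Algebra.Properties.CommutativeSemigroup +-commutativeSemigroup using (interchange)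
open import Data.Fin using (Fin; inject₁) renaming (zero to fzero; suc to fsuc)
open import Data.Fin.Properties using (any?)
open import Data.Fin.Subset
open import Data.Fin.Subset.Properties
open import Data.Vec using (_∷_; here; there)
open import Data.Product using (_×_; ∃-syntax; _,_)
open import Data.Sum using (_⊎_; inj₁; inj₂)
open import Function using (_∘_)
open import Relation.Nullary using (Dec; yes; no; ¬_; ¬?)
open import Relation.Nullary.Decidable using (_×-dec_)
open import Relation.Nullary.Negation using (contradiction)
open import Relation.Binary.PropositionalEquality

+-interchange-≤ : ∀ a b c d {x y u v} → a + b ≤ c + d → x + y ≤ u + v
                → (a + x) + (b + y) ≤ (c + u) + (d + v)
+-interchange-≤ a b c d {x} {y} {u} {v} ab≤cd xy≤uv =
  subst₂ _≤_ (interchange a b x y) (interchange c d u v) (+-mono-≤ ab≤cd xy≤uv)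

x∈p─q⇒x∉q : ∀ {n} (p q : Subset n) {x} → x ∈ p ─ q → x ∉ q
x∈p─q⇒x∉q (inside ∷ p) (outside ∷ q) here      ()
x∈p─q⇒x∉q (_ ∷ p)      (inside ∷ q)  (there h) (there h′) = x∈p─q⇒x∉q p q h h′
x∈p─q⇒x∉q (_ ∷ p)      (outside ∷ q) (there h) (there h′) = x∈p─q⇒x∉q p q h h′

module _ {n : ℕ} where

  x∈p-y⇒x∈p : ∀ {p : Subset n} {x y} → x ∈ p - y → x ∈ p
  x∈p-y⇒x∈p {p} {y = y} = p─q⊆p p ⁅ y ⁆

  x∈p-y⇒x≢y : ∀ {p : Subset n} {x y} → x ∈ p - y → x ≢ y
  x∈p-y⇒x≢y {p} {y = y} h = x∉⁅y⁆⇒x≢y (x∈p─q⇒x∉q p ⁅ y ⁆ h)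

  p⊆q⇒p-x⊆q-x : ∀ {p q : Subset n} {x} → p ⊆ q → p - x ⊆ q - x
  p⊆q⇒p-x⊆q-x p⊆q h = x∈p∧x≢y⇒x∈p-y (p⊆q (x∈p-y⇒x∈p h)) (x∈p-y⇒x≢y h)

  x∉p⇒p⊆p-x : ∀ {p : Subset n} {x} → x ∉ p → p ⊆ p - x
  x∉p⇒p⊆p-x x∉p y∈p = x∈p∧x≢y⇒x∈p-y y∈p λ { refl → x∉p y∈p }

  x∈q⇒p⊆p-x∪q : ∀ {p q : Subset n} {x} → x ∈ q → p ⊆ (p - x) ∪ q
  x∈q⇒p⊆p-x∪q {x = x} x∈q {y} y∈p with y Data.Fin.≟ x
  ... | yes refl = x∈p∪q⁺ (inj₂ x∈q)
  ... | no  y≢x  = x∈p∪q⁺ (inj₁ (x∈p∧x≢y⇒x∈p-y y∈p y≢x))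

  p∪q-x⊆p-x∪q-x : ∀ (p q : Subset n) {x} → (p ∪ q) - x ⊆ (p - x) ∪ (q - x)
  p∪q-x⊆p-x∪q-x p q h with x∈p∪q⁻ p q (x∈p-y⇒x∈p h)
  ... | inj₁ y∈p = x∈p∪q⁺ (inj₁ (x∈p∧x≢y⇒x∈p-y y∈p (x∈p-y⇒x≢y h)))
  ... | inj₂ y∈q = x∈p∪q⁺ (inj₂ (x∈p∧x≢y⇒x∈p-y y∈q (x∈p-y⇒x≢y h)))

  p∩q-x⊆p-x∩q-x : ∀ (p q : Subset n) {x} → (p ∩ q) - x ⊆ (p - x) ∩ (q - x)
  p∩q-x⊆p-x∩q-x p q h =
    x∈p∩q⁺ (p⊆q⇒p-x⊆q-x (p∩q⊆p p q) h , p⊆q⇒p-x⊆q-x (p∩q⊆q p q) h)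

module RankProperties {n : ℕ} (M : Matroid n) where
  open Matroid M
  open ≤-Reasoning

  -- e is not a coloop of the restriction M|A
  Redundant : Subset n → Fin n → Set
  Redundant A e = r A ≤ r (A - e)

  r-remove-≤ : ∀ S e → r S ≤ suc (r (S - e))
  r-remove-≤ S e = begin
    r S                                       ≤⟨ r-mono _ _ (x∈q⇒p⊆p-x∪q (x∈⁅x⁆ e)) ⟩
    r ((S - e) ∪ ⁅ e ⁆)                       ≤⟨ m≤m+n _ _ ⟩
    r ((S - e) ∪ ⁅ e ⁆) + r ((S - e) ∩ ⁅ e ⁆) ≤⟨ r-submod (S - e) ⁅ e ⁆ ⟩
    r (S - e) + r ⁅ e ⁆                       ≤⟨ +-monoʳ-≤ (r (S - e)) r⁅e⁆≤1 ⟩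
    r (S - e) + 1                             ≡⟨ +-comm (r (S - e)) 1 ⟩
    suc (r (S - e))                           ∎
    where
    r⁅e⁆≤1 : r ⁅ e ⁆ ≤ 1
    r⁅e⁆≤1 = subst (r ⁅ e ⁆ ≤_) (∣⁅x⁆∣≡1 e) (r-bound ⁅ e ⁆)

  redundant-mono : ∀ {S T e} → e ∈ S → S ⊆ T → Redundant S e → Redundant T e
  redundant-mono {S} {T} {e} e∈S S⊆T red = +-cancelʳ-≤ (r (S - e)) (r T) (r (T - e)) (begin
    r T + r (S - e)                   ≤⟨ +-mono-≤ (r-mono _ _ (x∈q⇒p⊆p-x∪q e∈S)) (r-mono _ _ S-e⊆) ⟩
    r ((T - e) ∪ S) + r ((T - e) ∩ S) ≤⟨ r-submod (T - e) S ⟩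
    r (T - e) + r S                   ≤⟨ +-monoʳ-≤ (r (T - e)) red ⟩
    r (T - e) + r (S - e)             ∎)
    where
    S-e⊆ : S - e ⊆ (T - e) ∩ S
    S-e⊆ h = x∈p∩q⁺ (p⊆q⇒p-x⊆q-x S⊆T h , x∈p-y⇒x∈p h)

  submod-remove : ∀ A B {e} → Redundant (A ∪ B) e
                → r (A ∪ B) + r ((A ∩ B) - e) ≤ r (A - e) + r (B - e)
  submod-remove A B {e} red = begin
    r (A ∪ B) + r ((A ∩ B) - e)
      ≤⟨ +-mono-≤ (≤-trans red (r-mono _ _ (p∪q-x⊆p-x∪q-x A B))) (r-mono _ _ (p∩q-x⊆p-x∩q-x A B)) ⟩
    r ((A - e) ∪ (B - e)) + r ((A - e) ∩ (B - e)) ≤⟨ r-submod (A - e) (B - e) ⟩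
    r (A - e) + r (B - e)                         ∎

  submod-strict : ∀ A B {e} → e ∈ A ∪ B
                → (e ∈ A → r (A - e) < r A) → (e ∈ B → r (B - e) < r B)
                → Redundant (A ∪ B) e → suc (r (A ∪ B) + r (A ∩ B)) ≤ r A + r B
  submod-strict A B {e} e∈A∪B colA colB red with e ∈? A ∩ B
  ... | yes e∈A∩B = let (e∈A , e∈B) = x∈p∩q⁻ A B e∈A∩B in begin
    suc (r (A ∪ B) + r (A ∩ B))              ≤⟨ s≤s (+-monoʳ-≤ (r (A ∪ B)) (r-remove-≤ (A ∩ B) e)) ⟩
    suc (r (A ∪ B) + suc (r ((A ∩ B) - e))) ≡⟨ cong suc (+-suc (r (A ∪ B)) _) ⟩
    suc (suc (r (A ∪ B) + r ((A ∩ B) - e))) ≤⟨ s≤s (s≤s (submod-remove A B red)) ⟩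
    suc (suc (r (A - e) + r (B - e)))       ≡⟨ cong suc (+-suc (r (A - e)) (r (B - e))) ⟨
    suc (r (A - e)) + suc (r (B - e))       ≤⟨ +-mono-≤ (colA e∈A) (colB e∈B) ⟩
    r A + r B                               ∎
  ... | no e∉A∩B = begin
    suc (r (A ∪ B) + r (A ∩ B))       ≤⟨ s≤s (+-monoʳ-≤ (r (A ∪ B)) (r-mono _ _ (x∉p⇒p⊆p-x e∉A∩B))) ⟩
    suc (r (A ∪ B) + r ((A ∩ B) - e)) ≤⟨ s≤s (submod-remove A B red) ⟩
    suc (r (A - e) + r (B - e))       ≤⟨ one-side-drops (x∈p∪q⁻ A B e∈A∪B) ⟩
    r A + r B                         ∎
    where
    one-side-drops : e ∈ A ⊎ e ∈ B → r (A - e) + r (B - e) < r A + r B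
    one-side-drops (inj₁ e∈A) = +-mono-<-≤ (colA e∈A) (r-mono _ _ (p─q⊆p B ⁅ e ⁆))
    one-side-drops (inj₂ e∈B) = +-mono-≤-< (r-mono _ _ (p─q⊆p A ⁅ e ⁆)) (colB e∈B)

module ElementaryLift {n : ℕ} (M : Matroid n) (Z : Subset n) where
  open Matroid M
  open RankProperties M
  open ≤-Reasoning

  RedundantOutside : Subset n → Set
  RedundantOutside A = ∃[ e ] (e ∈ A × e ∉ Z × Redundant A e)

  RedundantOutside? : ∀ A → Dec (RedundantOutside A)
  RedundantOutside? A = any? λ e → (e ∈? A) ×-dec ¬? (e ∈? Z) ×-dec (r A ≤? r (A - e))

  -- Opaque, so that a `with` on RedundantOutside? does not unfold r′ in goals.
  opaque
    excess : Subset n → ℕ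
    excess A with RedundantOutside? A
    ... | yes _ = 1
    ... | no  _ = 0

    excess-yes : ∀ {A} → RedundantOutside A → excess A ≡ 1
    excess-yes {A} d with RedundantOutside? A
    ... | yes _  = refl
    ... | no  ¬d = contradiction d ¬d

    excess-no : ∀ {A} → ¬ RedundantOutside A → excess A ≡ 0
    excess-no {A} ¬d with RedundantOutside? A
    ... | yes d = contradiction d ¬d
    ... | no  _ = refl

  excess≤1 : ∀ A → excess A ≤ 1
  excess≤1 A with RedundantOutside? A
  ... | yes d  = ≤-reflexive (excess-yes d)
  ... | no  ¬d = subst (_≤ _) (sym (excess-no ¬d)) z≤n

  redundantOutside-mono : ∀ {A B} → A ⊆ B → RedundantOutside A → RedundantOutside B
  redundantOutside-mono A⊆B (e , e∈A , e∉Z , red) =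
    e , A⊆B e∈A , e∉Z , redundant-mono e∈A A⊆B red

  excess-mono : ∀ {A B} → A ⊆ B → excess A ≤ excess B
  excess-mono {A} {B} A⊆B with RedundantOutside? A
  ... | yes d  = ≤-reflexive (trans (excess-yes d) (sym (excess-yes (redundantOutside-mono A⊆B d))))
  ... | no  ¬d = subst (_≤ _) (sym (excess-no ¬d)) z≤n

  ¬RedundantOutside⇒coloop : ∀ {A e} → ¬ RedundantOutside A → e ∉ Z → e ∈ A → r (A - e) < r A
  ¬RedundantOutside⇒coloop ¬d e∉Z e∈A = ≰⇒> λ red → ¬d (_ , e∈A , e∉Z , red)

  excess-submod : ∀ A B → RedundantOutside A ⊎ RedundantOutside B ⊎ ¬ RedundantOutside (A ∪ B)
                → excess (A ∪ B) + excess (A ∩ B) ≤ excess A + excess B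
  excess-submod A B (inj₁ dA) = begin
    excess (A ∪ B) + excess (A ∩ B) ≤⟨ +-mono-≤ (excess≤1 (A ∪ B)) (excess-mono (p∩q⊆q A B)) ⟩
    1 + excess B                    ≡⟨ cong (_+ excess B) (excess-yes dA) ⟨
    excess A + excess B             ∎
  excess-submod A B (inj₂ (inj₁ dB)) = begin
    excess (A ∪ B) + excess (A ∩ B) ≤⟨ +-mono-≤ (excess≤1 (A ∪ B)) (excess-mono (p∩q⊆p A B)) ⟩
    1 + excess A                    ≡⟨ cong (_+ excess A) (excess-yes dB) ⟨
    excess B + excess A             ≡⟨ +-comm (excess B) (excess A) ⟩
    excess A + excess B             ∎
  excess-submod A B (inj₂ (inj₂ ¬d)) = begin
    excess (A ∪ B) + excess (A ∩ B) ≡⟨ cong (_+ excess (A ∩ B)) (excess-no ¬d) ⟩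
    excess (A ∩ B)                  ≤⟨ excess-mono (p∩q⊆p A B) ⟩
    excess A                        ≤⟨ m≤m+n (excess A) (excess B) ⟩
    excess A + excess B             ∎

  submod-strict-outside : ∀ {A B} → ¬ RedundantOutside A → ¬ RedundantOutside B
                        → RedundantOutside (A ∪ B) → suc (r (A ∪ B) + r (A ∩ B)) ≤ r A + r B
  submod-strict-outside {A} {B} ¬dA ¬dB (e , e∈A∪B , e∉Z , red) =
    submod-strict A B e∈A∪B (¬RedundantOutside⇒coloop ¬dA e∉Z)
                            (¬RedundantOutside⇒coloop ¬dB e∉Z) red

  r′ : Subset n → ℕ
  r′ A = r A + excess A

  r′-bound : ∀ A → r′ A ≤ ∣ A ∣
  r′-bound A with RedundantOutside? A
  ... | no ¬d = begin
    r A + excess A ≡⟨ cong (r A +_) (excess-no ¬d) ⟩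
    r A + 0        ≡⟨ +-identityʳ (r A) ⟩
    r A            ≤⟨ r-bound A ⟩
    ∣ A ∣          ∎
  ... | yes d@(e , e∈A , _ , red) = begin
    r A + excess A  ≡⟨ cong (r A +_) (excess-yes d) ⟩
    r A + 1         ≡⟨ +-comm (r A) 1 ⟩
    suc (r A)       ≤⟨ s≤s red ⟩
    suc (r (A - e)) ≤⟨ s≤s (r-bound (A - e)) ⟩
    suc ∣ A - e ∣   ≤⟨ x∈p⇒∣p-x∣<∣p∣ e∈A ⟩
    ∣ A ∣           ∎

  r′-mono : ∀ A B → A ⊆ B → r′ A ≤ r′ B
  r′-mono A B A⊆B = +-mono-≤ (r-mono A B A⊆B) (excess-mono A⊆B)

  r′-submod-excess : ∀ A B → RedundantOutside A ⊎ RedundantOutside B ⊎ ¬ RedundantOutside (A ∪ B)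
                   → r′ (A ∪ B) + r′ (A ∩ B) ≤ r′ A + r′ B
  r′-submod-excess A B =
    +-interchange-≤ (r (A ∪ B)) (r (A ∩ B)) (r A) (r B) (r-submod A B) ∘ excess-submod A B

  r′-submod-strict : ∀ {A B} → ¬ RedundantOutside A → ¬ RedundantOutside B
                   → RedundantOutside (A ∪ B) → r′ (A ∪ B) + r′ (A ∩ B) ≤ r′ A + r′ B
  r′-submod-strict {A} {B} ¬dA ¬dB d = begin
    r′ (A ∪ B) + r′ (A ∩ B)           ≡⟨ cong₂ _+_ (cong (r (A ∪ B) +_) (excess-yes d))
                                                   (cong (r (A ∩ B) +_) (excess-no ¬dA∩B)) ⟩
    (r (A ∪ B) + 1) + (r (A ∩ B) + 0) ≡⟨ cong₂ _+_ (+-comm (r (A ∪ B)) 1) (+-identityʳ (r (A ∩ B))) ⟩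
    suc (r (A ∪ B) + r (A ∩ B))       ≤⟨ submod-strict-outside ¬dA ¬dB d ⟩
    r A + r B                         ≡⟨ cong₂ _+_ (+-identityʳ (r A)) (+-identityʳ (r B)) ⟨
    (r A + 0) + (r B + 0)             ≡⟨ cong₂ _+_ (cong (r A +_) (excess-no ¬dA))
                                                   (cong (r B +_) (excess-no ¬dB)) ⟨
    r′ A + r′ B                       ∎
    where
    ¬dA∩B : ¬ RedundantOutside (A ∩ B)
    ¬dA∩B = ¬dA ∘ redundantOutside-mono (p∩q⊆p A B)

  r′-submod : ∀ A B → r′ (A ∪ B) + r′ (A ∩ B) ≤ r′ A + r′ B
  r′-submod A B with RedundantOutside? A | RedundantOutside? B | RedundantOutside? (A ∪ B)
  ... | yes dA | _      | _      = r′-submod-excess A B (inj₁ dA)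
  ... | no _   | yes dB | _      = r′-submod-excess A B (inj₂ (inj₁ dB))
  ... | no _   | no _   | no ¬d  = r′-submod-excess A B (inj₂ (inj₂ ¬d))
  ... | no ¬dA | no ¬dB | yes d  = r′-submod-strict ¬dA ¬dB d

  lift : Matroid n
  lift = record { r = r′ ; r-bound = r′-bound ; r-mono = r′-mono ; r-submod = r′-submod }

  rank-lift : rank lift ≤ rank M + 1
  rank-lift = +-monoʳ-≤ (r ⊤) (excess≤1 ⊤)

  lift-preserves-flat : ∀ {F} → IsFlat M F → IsFlat lift F
  lift-preserves-flat F-flat e e∉F = +-mono-<-≤ (F-flat e e∉F) (excess-mono (p⊆p∪q ⁅ e ⁆))

  -- If adding e ∉ Z to Z does not raise the rank of M, then e becomes a redundant
  -- element outside Z, and the excess raises it instead.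
  lift-Z-flat : IsFlat lift Z
  lift-Z-flat e e∉Z = begin-strict
    r Z + excess Z ≡⟨ cong (r Z +_) (excess-no λ { (_ , f∈Z , f∉Z , _) → f∉Z f∈Z }) ⟩
    r Z + 0        ≡⟨ +-identityʳ (r Z) ⟩
    r Z            <⟨ grows (m≤n⇒m<n∨m≡n (r-mono Z (Z ∪ ⁅ e ⁆) (p⊆p∪q ⁅ e ⁆))) ⟩
    r′ (Z ∪ ⁅ e ⁆) ∎
    where
    grows : r Z < r (Z ∪ ⁅ e ⁆) ⊎ r Z ≡ r (Z ∪ ⁅ e ⁆) → r Z < r′ (Z ∪ ⁅ e ⁆)
    grows (inj₁ r<) = <-≤-trans r< (m≤m+n _ _)
    grows (inj₂ r≡) = begin-strict
      r Z                 <⟨ n<1+n (r Z) ⟩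
      suc (r Z)           ≡⟨ cong suc r≡ ⟩
      suc (r (Z ∪ ⁅ e ⁆)) ≡⟨ +-comm 1 _ ⟩
      r (Z ∪ ⁅ e ⁆) + 1   ≡⟨ cong (r (Z ∪ ⁅ e ⁆) +_) (excess-yes (e , e∈Z∪e , e∉Z , red)) ⟨
      r′ (Z ∪ ⁅ e ⁆)      ∎
      where
      e∈Z∪e : e ∈ Z ∪ ⁅ e ⁆
      e∈Z∪e = x∈p∪q⁺ (inj₂ (x∈⁅x⁆ e))
      red : Redundant (Z ∪ ⁅ e ⁆) e
      red = subst (_≤ r ((Z ∪ ⁅ e ⁆) - e)) r≡
                  (r-mono _ _ (p⊆q⇒p-x⊆q-x (p⊆p∪q ⁅ e ⁆) ∘ x∉p⇒p⊆p-x e∉Z))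

appendRow-inject₁ : ∀ {m n} (X : Pattern m n) ρ (i : Fin m) → appendRow X ρ (inject₁ i) ≡ X i
appendRow-inject₁ {suc m} X ρ fzero    = refl
appendRow-inject₁ {suc m} X ρ (fsuc i) = appendRow-inject₁ (λ k → X (fsuc k)) ρ i

appendRow-row : ∀ {m n} (X : Pattern m n) ρ (j : Fin (suc m))
              → (∃[ i ] appendRow X ρ j ≡ X i) ⊎ appendRow X ρ j ≡ ρ
appendRow-row {zero}  X ρ fzero    = inj₂ refl
appendRow-row {suc m} X ρ fzero    = inj₁ (fzero , refl)
appendRow-row {suc m} X ρ (fsuc j) with appendRow-row (λ k → X (fsuc k)) ρ j
... | inj₁ (i , eq) = inj₁ (fsuc i , eq)
... | inj₂ eq       = inj₂ eq

InR-appendRow⁻ : ∀ {m n} (X : Pattern m n) ρ (M : Matroid n) → InR (appendRow X ρ) M → InR X M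
InR-appendRow⁻ X ρ M M∈R′ i =
  subst (λ σ → IsFlat M (zeroSet σ)) (appendRow-inject₁ X ρ i) (M∈R′ (inject₁ i))

InR-lift : ∀ {m n} (X : Pattern m n) ρ (M : Matroid n) → InR X M
         → InR (appendRow X ρ) (ElementaryLift.lift M (zeroSet ρ))
InR-lift X ρ M M∈R j = row-flat (appendRow-row X ρ j)
  where
  open ElementaryLift M (zeroSet ρ)
  row-flat : (∃[ i ] appendRow X ρ j ≡ X i) ⊎ appendRow X ρ j ≡ ρ
           → IsFlat lift (zeroSet (appendRow X ρ j))
  row-flat (inj₁ (i , eq)) rewrite eq = lift-preserves-flat (M∈R i)
  row-flat (inj₂ eq)       rewrite eq = lift-Z-flat

theorem3p8 : {m n : ℕ} (X : Pattern m n) (ρ : Fin n → Entry) (k k′ : ℕ)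
    → IsMatroidMinRank X k
    → IsMatroidMinRank (appendRow X ρ) k′
    → k ≤ k′ × k′ ≤ k + 1
theorem3p8 X ρ k k′ ((M , M∈R , refl) , minimal) ((M′ , M′∈R′ , refl) , minimal′) =
  minimal M′ (InR-appendRow⁻ X ρ M′ M′∈R′) ,
  ≤-trans (minimal′ lift (InR-lift X ρ M M∈R)) rank-lift
  where open ElementaryLift M (zeroSet ρ) using (lift; rank-lift)
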